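{- Let $L=\varprojlim_{i\in I}L_i$, where $\{L_i,\varphi_{ij},I\}$ is an inverse system of finite residuated lattices, and let $\pi_i:L\to L_i$ ($i\in I$) be the projection homomorphisms. Then $\{S_i : S_i=\mathrm{Ker}(\pi_i),\ i\in I\}$ is a fundamental system of open neighborhoods of $1$ in $L$ (with respect to the profinite topology on $L$); that is, each $S_i$ is an open set containing $1$, and every neighborhood of $1$ contains some $S_i$.
   Context: A residuated lattice is an algebra $(L,\wedge,\vee,\odot,\rightarrow,0,1)$ such that $(L,\wedge,\vee,0,1)$ is a bounded lattice, $(L,\odot,1)$ is a commutative monoid, and $x\odot y\le z$ iff $x\le y\rightarrow z$. An inverse system $\{L_i,\varphi_{ij},I\}$ of residuated lattices consists of a directed poset $(I,\le)$, residuated lattices $L_i$, and homomorphisms $\varphi_{ij}:L_i\to L_j$ for $j\le i$ with $\varphi_{ii}=\mathrm{id}$ and $\varphi_{ik}=\varphi_{jk}\circ\varphi_{ij}$ for $k\le j\le i$. Its inverse limit is $\{(a_i)\in\prod_{i\in I}L_i:\varphi_{ij}(a_i)=a_j\ \forall j\le i\}$, a subalgebra of the product, and $\pi_i$ is the restriction to it of the $i$-th coordinate projection. The profinite topology on $L$ is the subspace topology from $\prod_{i\in I}L_i$ where each finite $L_i$ is discrete. For a homomorphism $\pi$, $\mathrm{Ker}(\pi)=\{x\in L:\pi(x)=1\}$. -}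

module Defs where

open import Data.Nat using (ℕ)
open import Data.Fin using (Fin)
open import Data.List using (List)
open import Data.List.Membership.Propositional using (_∈_)
open import Data.Product using (Σ; ∃; _×_; _,_)
open import Function.Bundles using (_↔_; _⇔_)
open import Relation.Binary.PropositionalEquality using (_≡_)
open import Relation.Binary.Structures using (IsPartialOrder)

record ResiduatedLattice : Set₁ where
  infixr 8 _⊙_
  infixr 7 _∧_
  infixr 6 _∨_
  infixr 5 _⇒_
  field
    Carrier : Set
    _∧_ _∨_ _⊙_ _⇒_ : Carrier → Carrier → Carrier
    𝟘 𝟙 : Carrier
    ∧-assoc : ∀ x y z → (x ∧ y) ∧ z ≡ x ∧ (y ∧ z)
    ∨-assoc : ∀ x y z → (x ∨ y) ∨ z ≡ x ∨ (y ∨ z)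
    ∧-comm  : ∀ x y → x ∧ y ≡ y ∧ x
    ∨-comm  : ∀ x y → x ∨ y ≡ y ∨ x
    ∧-absorbs-∨ : ∀ x y → x ∧ (x ∨ y) ≡ x
    ∨-absorbs-∧ : ∀ x y → x ∨ (x ∧ y) ≡ x
    𝟘-least    : ∀ x → 𝟘 ∧ x ≡ 𝟘
    𝟙-greatest : ∀ x → x ∧ 𝟙 ≡ x
    ⊙-assoc : ∀ x y z → (x ⊙ y) ⊙ z ≡ x ⊙ (y ⊙ z)
    ⊙-comm  : ∀ x y → x ⊙ y ≡ y ⊙ x
    ⊙-identityʳ : ∀ x → x ⊙ 𝟙 ≡ x

  infix 4 _≤_
  _≤_ : Carrier → Carrier → Set
  x ≤ y = x ∧ y ≡ x

  field
    residuated : ∀ x y z → ((x ⊙ y) ≤ z) ⇔ (x ≤ (y ⇒ z))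

open ResiduatedLattice public using (Carrier)

record IsHom (A B : ResiduatedLattice) (f : Carrier A → Carrier B) : Set where
  private
    module A = ResiduatedLattice A
    module B = ResiduatedLattice B
  field
    pres-∧ : ∀ x y → f (x A.∧ y) ≡ f x B.∧ f y
    pres-∨ : ∀ x y → f (x A.∨ y) ≡ f x B.∨ f y
    pres-⊙ : ∀ x y → f (x A.⊙ y) ≡ f x B.⊙ f y
    pres-⇒ : ∀ x y → f (x A.⇒ y) ≡ f x B.⇒ f y
    pres-𝟘 : f A.𝟘 ≡ B.𝟘
    pres-𝟙 : f A.𝟙 ≡ B.𝟙

Finite : ResiduatedLattice → Set
Finite A = Σ ℕ λ n → Fin n ↔ Carrier A

record DirectedPoset : Set₁ where
  field
    Index : Set
    _≼_   : Index → Index → Set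
    isPartialOrder : IsPartialOrder _≡_ _≼_
    inhabited : Index
    directed  : ∀ i j → ∃ λ k → (i ≼ k) × (j ≼ k)

record InverseSystem (P : DirectedPoset) : Set₁ where
  open DirectedPoset P
  field
    L   : Index → ResiduatedLattice
    φ   : ∀ i j → j ≼ i → Carrier (L i) → Carrier (L j)
    φ-hom  : ∀ i j (p : j ≼ i) → IsHom (L i) (L j) (φ i j p)
    φ-id   : ∀ i (p : i ≼ i) x → φ i i p x ≡ x
    φ-comp : ∀ i j k (p : j ≼ i) (q : k ≼ j) (r : k ≼ i) x →
             φ i k r x ≡ φ j k q (φ i j p x)

  record Limit : Set where
    constructor thread
    field
      at     : (i : Index) → Carrier (L i)
      compat : ∀ i j (p : j ≼ i) → φ i j p (at i) ≡ at j
  open Limit public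

  π : (i : Index) → Limit → Carrier (L i)
  π i x = at x i

  𝟙L : Limit
  𝟙L = thread (λ i → ResiduatedLattice.𝟙 (L i))
              (λ i j p → IsHom.pres-𝟙 (φ-hom i j p))

  Ker : Index → Limit → Set
  Ker i x = π i x ≡ ResiduatedLattice.𝟙 (L i)

  -- Profinite topology: subspace topology on Limit induced by the
  -- product topology of the discrete spaces L i.  Basic open sets of
  -- the product are the cylinders fixing finitely many coordinates;
  -- a subset U of Limit is open iff every point of U has a basic
  -- cylinder neighbourhood whose trace on Limit lies in U.

  Subset : Set₁
  Subset = Limit → Set

  Cylinder : List Index → Limit → Subset
  Cylinder F x y = ∀ j → j ∈ F → π j y ≡ π j x

  IsOpen : Subset → Set
  IsOpen U = ∀ x → U x → ∃ λ (F : List Index) → ∀ y → Cylinder F x y → U y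

  IsNeighbourhood : Subset → Limit → Set₁
  IsNeighbourhood N x = Σ Subset λ U → IsOpen U × U x × (∀ y → U y → N y)

{-# OPTIONS --safe #-}
module Submission where

-- Ker πᵢ is the cylinder fixing the single coordinate i at 1, hence open.  A
-- neighbourhood of 1 contains a cylinder fixing finitely many coordinates F at 1;
-- taking k above all of F, an element of Ker πₖ is 1 at every j ≼ k, because its
-- j-th coordinate is the image of its k-th one under the homomorphism φₖⱼ.

open import Defs
open import Data.Product using (∃; _×_; _,_)
open import Data.List using (List; []; _∷_)
open import Data.List.Relation.Unary.Any using (here; there)
open import Data.List.Membership.Propositional using (_∈_)
open import Relation.Binary.PropositionalEquality using (refl; sym; trans; cong; module ≡-Reasoning)
open import Relation.Binary.Structures using (IsPartialOrder)

module _ (P : DirectedPoset) where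
  open DirectedPoset P

  ≼-trans : ∀ {a b c} → a ≼ b → b ≼ c → a ≼ c
  ≼-trans = IsPartialOrder.trans isPartialOrder

  upperBound : (F : List Index) → ∃ λ k → ∀ j → j ∈ F → j ≼ k
  upperBound []      = inhabited , λ _ ()
  upperBound (a ∷ F) with upperBound F
  ... | k , F≼k with directed a k
  ... | m , a≼m , k≼m = m , λ { _ (here refl) → a≼m ; j (there j∈F) → ≼-trans (F≼k j j∈F) k≼m }

module _ {P : DirectedPoset} (S : InverseSystem P) where
  open DirectedPoset P
  open InverseSystem S

  Ker-isOpen : ∀ i → IsOpen (Ker i)
  Ker-isOpen i x x∈Ker = i ∷ [] , λ y y~x → trans (y~x i (here refl)) x∈Ker

  Ker-antitone : ∀ {j k} → j ≼ k → ∀ y → Ker k y → Ker j y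
  Ker-antitone {j} {k} j≼k y y∈Ker = begin
    π j y                                 ≡⟨ sym (compat y k j j≼k) ⟩
    φ k j j≼k (π k y)                     ≡⟨ cong (φ k j j≼k) y∈Ker ⟩
    φ k j j≼k (ResiduatedLattice.𝟙 (L k)) ≡⟨ IsHom.pres-𝟙 (φ-hom k j j≼k) ⟩
    ResiduatedLattice.𝟙 (L j)             ∎
    where open ≡-Reasoning

  Ker-⊆-Cylinder : ∀ {F k} → (∀ j → j ∈ F → j ≼ k) → ∀ y → Ker k y → Cylinder F 𝟙L y
  Ker-⊆-Cylinder F≼k y y∈Ker j j∈F = Ker-antitone (F≼k j j∈F) y y∈Ker

proposition3p9 : (P : DirectedPoset) (S : InverseSystem P) →
    (∀ i → Finite (InverseSystem.L S i)) →
    let open DirectedPoset P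
        open InverseSystem S
    in (∀ i → IsOpen (Ker i) × Ker i 𝟙L)
       × (∀ (N : Subset) → IsNeighbourhood N 𝟙L → ∃ λ i → ∀ y → Ker i y → N y)
proposition3p9 P S _ = (λ i → Ker-isOpen S i , refl) , Ker-fundamental
  where
  open InverseSystem S

  Ker-fundamental : ∀ N → IsNeighbourhood N 𝟙L → ∃ λ i → ∀ y → Ker i y → N y
  Ker-fundamental N (U , U-open , 𝟙∈U , U⊆N) with U-open 𝟙L 𝟙∈U
  ... | F , cylinder⊆U with upperBound P F
  ... | k , F≼k = k , λ y y∈Ker → U⊆N y (cylinder⊆U y (Ker-⊆-Cylinder S F≼k y y∈Ker))
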